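{- Assume univalence and propositional truncations. If $A:\mathcal{U}$ is inhabited, then every proposition $P:\mathcal{U}$ is logically equivalent to the identity type $(P\times A)=A$.
   Context: Work in intensional Martin-Löf type theory with $\Pi$-, $\Sigma$-, identity, finite types and natural numbers, a univalent universe $\mathcal{U}$ closed under these, and propositional truncations $\|C\|$ (universal proposition receiving a map from $C$). A type is a proposition if any two elements are equal. $A$ is inhabited if there is an element of $\|A\|$. Types are logically equivalent if there are maps in both directions. -}

{-# OPTIONS --without-K #-}
module Defs where

open import Level using (Level; suc; _⊔_)
open import Data.Product using (Σ; _×_; _,_; proj₁)
open import Relation.Binary.PropositionalEquality using (_≡_; refl)

-- Book-HoTT notions (stdlib's ≡ is the intensional identity type under --without-K).

isProp : ∀ {ℓ} → Set ℓ → Set ℓ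
isProp P = (x y : P) → x ≡ y

isContr : ∀ {ℓ} → Set ℓ → Set ℓ
isContr X = Σ X λ c → (x : X) → c ≡ x

fiber : ∀ {ℓ ℓ'} {X : Set ℓ} {Y : Set ℓ'} → (X → Y) → Y → Set (ℓ ⊔ ℓ')
fiber {X = X} f y = Σ X λ x → f x ≡ y

isEquiv : ∀ {ℓ ℓ'} {X : Set ℓ} {Y : Set ℓ'} → (X → Y) → Set (ℓ ⊔ ℓ')
isEquiv f = ∀ y → isContr (fiber f y)

_≃_ : ∀ {ℓ ℓ'} → Set ℓ → Set ℓ' → Set (ℓ ⊔ ℓ')
X ≃ Y = Σ (X → Y) isEquiv

idEquiv : ∀ {ℓ} (X : Set ℓ) → X ≃ X
idEquiv X = (λ x → x) , λ y → (y , refl) , λ { (x , refl) → refl }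

idtoeqv : ∀ {ℓ} {X Y : Set ℓ} → X ≡ Y → X ≃ Y
idtoeqv {X = X} refl = idEquiv X

Univalence : (ℓ : Level) → Set (suc ℓ)
Univalence ℓ = (X Y : Set ℓ) → isEquiv (idtoeqv {ℓ} {X} {Y})

record PropTrunc (ℓ : Level) : Set (suc ℓ) where
  field
    ∥_∥     : Set ℓ → Set ℓ
    ∣_∣     : ∀ {C : Set ℓ} → C → ∥ C ∥
    ∥∥-prop : ∀ {C : Set ℓ} → isProp ∥ C ∥
    ∥∥-rec  : ∀ {C B : Set ℓ} → isProp B → (C → B) → ∥ C ∥ → B

_⇔_ : ∀ {ℓ ℓ'} → Set ℓ → Set ℓ' → Set (ℓ ⊔ ℓ')
X ⇔ Y = (X → Y) × (Y → X)

{-# OPTIONS --safe --without-K #-}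
module Submission where

open import Defs
open import Data.Product using (_×_; _,_; proj₁; proj₂)
open import Function using (id)
open import Relation.Binary.PropositionalEquality using (_≡_; refl; cong; sym; subst)

ua : ∀ {ℓ} → Univalence ℓ → {X Y : Set ℓ} → X ≃ Y → X ≡ Y
ua univ {X} {Y} e = proj₁ (proj₁ (univ X Y e))

coe : ∀ {ℓ} {X Y : Set ℓ} → X ≡ Y → X → Y
coe = subst id

proj₂-isEquiv : ∀ {ℓ ℓ'} {P : Set ℓ} {A : Set ℓ'} → isProp P → P →
                isEquiv (proj₂ {A = P} {B = λ _ → A})
proj₂-isEquiv isProp-P p a =
  ((p , a) , refl) , λ { ((q , .a) , refl) → cong (λ r → (r , a) , refl) (isProp-P p q) }

×-inhabitedProp-≃ : ∀ {ℓ ℓ'} {P : Set ℓ} {A : Set ℓ'} → isProp P → P → (P × A) ≃ A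
×-inhabitedProp-≃ isProp-P p = proj₂ , proj₂-isEquiv isProp-P p

×-inhabitedProp-≡ : ∀ {ℓ} → Univalence ℓ → {P A : Set ℓ} → isProp P → P → (P × A) ≡ A
×-inhabitedProp-≡ univ isProp-P p = ua univ (×-inhabitedProp-≃ isProp-P p)

×-≡⇒inhabited : ∀ {ℓ} {P A : Set ℓ} → (P × A) ≡ A → A → P
×-≡⇒inhabited e a = proj₁ (coe (sym e) a)

lemma3p9 : ∀ {ℓ} → Univalence ℓ → (pt : PropTrunc ℓ) → (A : Set ℓ) → PropTrunc.∥_∥ pt A
    → (P : Set ℓ) → isProp P → P ⇔ ((P × A) ≡ A)
lemma3p9 univ pt A ∣A∣ P isProp-P =
    ×-inhabitedProp-≡ univ isProp-P
  , λ e → ∥∥-rec isProp-P (×-≡⇒inhabited e) ∣A∣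
  where open PropTrunc pt
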